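{- Let $G$ be a finite simple undirected graph having at least two MCBs. Consider the Markov chain on the (finite) set of MCBs of $G$ whose transition from a state $\mathcal{M}$ is: (1) choose $C'\in\mathcal{C}_{\mathcal{R}}\setminus\mathcal{M}$ uniformly at random; (2) form $\mathcal{P}=\{C'\}\cup\mathcal{E}_{\mathcal{M}}(C')$; (3) choose uniformly at random a cycle $C\in\mathcal{P}$ with $|C|=|C'|$, and move to $\mathcal{M}'=(\mathcal{M}\setminus\{C\})\cup\{C'\}$ (so $\mathcal{M}'=\mathcal{M}$ if $C=C'$). Then this Markov chain is ergodic (irreducible and aperiodic).
   Context: Let $G=(V,E)$ be a finite simple undirected graph. A cycle is a set $C\subseteq E$ such that every vertex of $G$ has even degree in the subgraph with edge set $C$; $|C|$ denotes the number of edges. The cycles form a vector space over $GF(2)$ with addition the symmetric difference $\oplus$. A minimum cycle basis (MCB) is a basis $\mathcal{M}$ of this space minimizing $\sum_{B\in\mathcal{M}}|B|$. The set of relevant cycles $\mathcal{C}_{\mathcal{R}}$ is the union of all MCBs. For a basis $\mathcal{B}$ and a cycle $C$, $\mathcal{E}_{\mathcal{B}}(C)$ denotes the unique subset of $\mathcal{B}$ whose $\oplus$-sum is $C$. (All MCBs have the same size, so having at least two MCBs guarantees $\mathcal{C}_{\mathcal{R}}\setminus\mathcal{M}\neq\emptyset$ for every MCB $\mathcal{M}$, making step (1) well-defined.) -}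

module Defs where

open import Data.Bool using (Bool; true; false; _∧_; _∨_; not; _xor_; if_then_else_)
open import Data.Bool.Properties using () renaming (_≟_ to _≟B_)
open import Data.Nat using (ℕ; zero; suc; _≤ᵇ_; _≡ᵇ_; _≤_)
open import Data.Nat.Divisibility using (_∣_; _∣?_)
open import Data.Fin using (Fin) renaming (_<_ to _<F_; _≟_ to _≟F_)
open import Data.Vec using (Vec; []; _∷_; zipWith; replicate; lookup)
open import Data.Vec.Properties using (≡-dec)
open import Data.List using (List; []; _∷_; _++_; map; foldr; filterᵇ; length; allFin; null)
open import Data.Bool.ListAction using (all; any)
open import Data.List.Membership.Propositional using (_∈_)
open import Data.Product using (_×_; proj₁; proj₂; ∃-syntax)
open import Data.Integer using (+_)
open import Data.Rational using (ℚ; 0ℚ; 1ℚ; _/_; _+_; _*_; _<_)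
open import Relation.Nullary using (does)
open import Relation.Binary.PropositionalEquality using (_≡_)

-- Vertices are Fin n, edges are labelled by Fin m; edge e joins the two
-- vertices ends e, stored with the smaller endpoint first (so no loops),
-- and distinct labels give distinct vertex pairs (so no multi-edges).

record Graph : Set where
  field
    n m    : ℕ
    ends   : Fin m → Fin n × Fin n
    loopless : ∀ e → proj₁ (ends e) <F proj₂ (ends e)
    simple : ∀ e f → ends e ≡ ends f → e ≡ f

open Graph public

-- An edge set C ⊆ E is its indicator vector.
EdgeSet : Graph → Set
EdgeSet G = Vec Bool (m G)

_⊕_ : ∀ {k} → Vec Bool k → Vec Bool k → Vec Bool k
_⊕_ = zipWith _xor_

empty : ∀ {k} → Vec Bool k
empty = replicate _ false

size : ∀ {k} → Vec Bool k → ℕ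
size [] = 0
size (true ∷ xs) = suc (size xs)
size (false ∷ xs) = size xs

_==_ : ∀ {k} → Vec Bool k → Vec Bool k → Bool
x == y = does (≡-dec _≟B_ x y)

_==L_ : ∀ {k} → List (Vec Bool k) → List (Vec Bool k) → Bool
[] ==L [] = true
(x ∷ xs) ==L (y ∷ ys) = (x == y) ∧ (xs ==L ys)
_ ==L _ = false

count : ∀ {A : Set} → (A → Bool) → List A → ℕ
count p xs = length (filterᵇ p xs)

allSets : ∀ k → List (Vec Bool k)
allSets zero = [] ∷ []
allSets (suc k) = map (false ∷_) (allSets k) ++ map (true ∷_) (allSets k)

sublists : ∀ {A : Set} → List A → List (List A)
sublists [] = [] ∷ []
sublists (x ∷ xs) = sublists xs ++ map (x ∷_) (sublists xs)

sumF : ∀ {k} → List (Vec Bool k) → Vec Bool k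
sumF = foldr _⊕_ empty

_∈ᵇ_ : ∀ {k} → Vec Bool k → List (Vec Bool k) → Bool
C ∈ᵇ F = any (C ==_) F

module _ (G : Graph) where

  incident : Fin (n G) → Fin (m G) → Bool
  incident v e = does (v ≟F proj₁ (ends G e)) ∨ does (v ≟F proj₂ (ends G e))

  degree : Fin (n G) → EdgeSet G → ℕ
  degree v C = count (λ e → lookup C e ∧ incident v e) (allFin (m G))

  isCycle : EdgeSet G → Bool
  isCycle C = all (λ v → does (2 ∣? degree v C)) (allFin (n G))

  cycles : List (EdgeSet G)
  cycles = filterᵇ isCycle (allSets (m G))

  -- A family of cycles is represented as a sublist of `cycles`
  -- (canonical representation of a set of cycles).
  independent : List (EdgeSet G) → Bool
  independent F = all (λ S → null S ∨ not (sumF S == empty)) (sublists F)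

  spans : List (EdgeSet G) → Bool
  spans F = all (λ C → any (λ S → sumF S == C) (sublists F)) cycles

  isBasis : List (EdgeSet G) → Bool
  isBasis F = independent F ∧ spans F

  bases : List (List (EdgeSet G))
  bases = filterᵇ isBasis (sublists cycles)

  weight : List (EdgeSet G) → ℕ
  weight F = foldr (λ C w → size C Data.Nat.+ w) 0 F

  isMCB : List (EdgeSet G) → Bool
  isMCB F = isBasis F ∧ all (λ B → weight F ≤ᵇ weight B) bases

  mcbs : List (List (EdgeSet G))
  mcbs = filterᵇ isMCB (sublists cycles)

  -- relevant cycles C_R: union of all MCBs
  relevant : List (EdgeSet G)
  relevant = filterᵇ (λ C → any (C ∈ᵇ_) mcbs) cycles

  relevantNotIn : List (EdgeSet G) → List (EdgeSet G)
  relevantNotIn M = filterᵇ (λ C → not (C ∈ᵇ M)) relevant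

  -- E_M(C) : the subfamily of M whose ⊕-sum is C (unique when M is a basis)
  firstOr : ∀ {A : Set} → A → List A → A
  firstOr d [] = d
  firstOr d (x ∷ _) = x

  expansion : List (EdgeSet G) → EdgeSet G → List (EdgeSet G)
  expansion M C = firstOr [] (filterᵇ (λ S → sumF S == C) (sublists M))

  -- P = {C'} ∪ E_M(C')   (C' ∉ M, so this list has no repetitions)
  Pset : List (EdgeSet G) → EdgeSet G → List (EdgeSet G)
  Pset M C' = C' ∷ expansion M C'

  candidates : List (EdgeSet G) → EdgeSet G → List (EdgeSet G)
  candidates M C' = filterᵇ (λ C → size C ≡ᵇ size C') (Pset M C')

  -- M' = (M ∖ {C}) ∪ {C'}, and M' = M when C = C'; canonical form
  exchange : List (EdgeSet G) → EdgeSet G → EdgeSet G → List (EdgeSet G)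
  exchange M C' C =
    if C == C' then M
    else filterᵇ (λ D → ((D ∈ᵇ M) ∧ not (D == C)) ∨ (D == C')) cycles

-- a / b as a rational (0 if b = 0; never used with b = 0 below on states)
frac : ℕ → ℕ → ℚ
frac a zero = 0ℚ
frac a (suc b) = (+ a) / suc b

sumℚ : ∀ {A : Set} → (A → ℚ) → List A → ℚ
sumℚ f = foldr (λ x s → f x + s) 0ℚ

module _ (G : Graph) where

  trans : List (EdgeSet G) → List (EdgeSet G) → ℚ
  trans M M' =
    sumℚ (λ C' → frac 1 (length (relevantNotIn G M))
                 * frac (count (λ C → exchange G M C' C ==L M') (candidates G M C'))
                        (length (candidates G M C')))
         (relevantNotIn G M)

  transPow : ℕ → List (EdgeSet G) → List (EdgeSet G) → ℚ
  transPow zero M M' = if M ==L M' then 1ℚ else 0ℚ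
  transPow (suc k) M M' = sumℚ (λ X → trans M X * transPow k X M') (mcbs G)

  Irreducible : Set
  Irreducible = ∀ M M' → M ∈ mcbs G → M' ∈ mcbs G → ∃[ k ] (0ℚ < transPow k M M')

  -- period of every state is 1: gcd { k ≥ 1 : P^k(M,M) > 0 } = 1
  Aperiodic : Set
  Aperiodic = ∀ M → M ∈ mcbs G →
    ∀ d → (∀ k → 1 ≤ k → 0ℚ < transPow k M M → d ∣ k) → d ≡ 1

  Ergodic : Set
  Ergodic = Irreducible × Aperiodic

-- Aperiodicity: every state has a self-loop. For an MCB M, the set C_R ∖ M is non-empty (an MCB
-- contained in M is a spanning subset of an independent set, hence equal to M, and there are at
-- least two MCBs), and choosing C = C′ in step (3) leaves M unchanged.
--
-- Irreducibility: let M ≠ M′ be MCBs and C′ ∈ M′ ∖ M. Some D ∈ E_M(C′) has C′ ∈ E_M′(D), since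
-- otherwise C′ would lie in the span of M′ ∖ {C′}. Then M − D + C′ and M′ − C′ + D are both bases,
-- so minimality of M and of M′ gives |D| ≤ |C′| ≤ |D|. Hence D is a candidate in step (3), the
-- chain moves from M to the MCB M − D + C′ with positive probability, and this MCB misses one
-- cycle of M′ fewer than M does.

{-# OPTIONS --safe #-}
module Submission where

open import Defs
open import Data.Nat using (_≤_)
open import Data.List using (length)

open import Algebra.Bundles using (CommutativeMonoid)
import Algebra.Properties.CommutativeSemigroup as CommutativeSemigroupProperties
open import Algebra.Structures using (IsCommutativeMonoid)
open import Data.Bool using (Bool; true; false; not; _∧_; _∨_; _xor_; if_then_else_; T)
open import Data.Bool.ListAction using (any)
open import Data.Bool.Properties
  using (∧-zeroʳ; ∧-identityʳ; ∨-zeroʳ; ∨-identityʳ; xor-assoc; xor-comm; xor-identityˡ; xor-identityʳ; xor-same;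
         T-≡; T-∧; T-∨; T-not-≡; ⇔→≡)
  renaming (_≟_ to _≟ᵇ_)
open import Data.Empty using (⊥-elim)
open import Data.Fin using (Fin; zero; suc; _≟_)
open import Data.Fin.Properties using (any?)
open import Data.List using (List; []; _∷_; map; foldr; lookup; null; filterᵇ)
open import Data.List.Membership.Propositional using (_∈_; find; lose)
open import Data.List.Membership.Propositional.Properties
  using (∈-length; ∈-lookup; ∈-filter⁺; ∈-filter⁻; ∈-++⁻; ∈-++⁺ˡ; ∈-++⁺ʳ; ∈-map⁺; ∈-map⁻)
import Data.List.Properties as List
open import Data.List.Relation.Binary.Disjoint.Propositional using (Disjoint)
import Data.List.Relation.Unary.All as All
open import Data.List.Relation.Unary.All.Properties using (all⁺; all⁻)
open import Data.List.Relation.Unary.AllPairs using ([]; _∷_)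
import Data.List.Relation.Unary.Any as Any
open import Data.List.Relation.Unary.Any using (here; there)
open import Data.List.Relation.Unary.Any.Properties using (any⁺; any⁻; lookup-index)
open import Data.List.Relation.Unary.Unique.Propositional using (Unique)
import Data.List.Relation.Unary.Unique.Propositional.Properties as Unique
open import Data.Nat using (ℕ; zero; suc; _+_; _<_; _≤ᵇ_; _≡ᵇ_; s≤s; z≤n)
open import Data.Nat.Divisibility using (∣1⇒≡1)
open import Data.Nat.Properties
  using (≤-refl; ≤-antisym; suc-injective; ≡⇒≡ᵇ; ≤ᵇ⇒≤; ≤⇒≤ᵇ; +-0-commutativeMonoid; +-cancelʳ-≤)
open import Data.Product using (_×_; _,_; ∃-syntax; proj₁; proj₂)
open import Data.Rational using (ℚ; _*_; Positive; NonNegative)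
open import Data.Rational.Properties
  using (normalize-nonNeg; normalize-pos; nonNeg+nonNeg⇒nonNeg; pos+nonNeg⇒pos; nonNeg+pos⇒pos;
         nonNeg*nonNeg⇒nonNeg; pos*pos⇒pos; positive⁻¹)
open import Data.Sum using (_⊎_; inj₁; inj₂)
open import Data.Vec using (Vec; []; _∷_)
import Data.Vec.Properties as Vec
open import Data.Vec.Properties using (≡-dec; zipWith-assoc; zipWith-comm; zipWith-identityˡ; zipWith-identityʳ)
import Data.Vec.Functional as Vector
open import Data.Vec.Functional using (Vector; updateAt; tail)
open import Data.Vec.Functional.Properties using (updateAt-updates; updateAt-minimal)
open import Function using (_∘_; const)
open import Function.Bundles using (_⇔_; mk⇔; Equivalence)
open import Level using (0ℓ)
open import Relation.Binary.PropositionalEquality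
  using (_≡_; _≢_; _≗_; refl; sym; cong; cong₂; subst; subst₂; isEquivalence; module ≡-Reasoning)
import Relation.Binary.PropositionalEquality as ≡
import Relation.Binary.Reasoning.Setoid as SetoidReasoning
open import Relation.Nullary using (¬_; yes; no; does)
open import Relation.Nullary.Decidable using (dec-true; dec-false; T?; _×-dec_)

private
  variable
    A : Set
    r : ℕ

-- Vectors over GF(2) and subsets of positions

⊕-self : ∀ {k} (x : Vec Bool k) → x ⊕ x ≡ empty
⊕-self []      = refl
⊕-self (b ∷ x) = cong₂ _∷_ (xor-same b) (⊕-self x)

⊕-isCommutativeMonoid : ∀ k → IsCommutativeMonoid _≡_ (_⊕_ {k}) empty
⊕-isCommutativeMonoid k = record
  { isMonoid = record
    { isSemigroup = record
      { isMagma  = record { isEquivalence = isEquivalence ; ∙-cong = cong₂ _⊕_ }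
      ; assoc    = zipWith-assoc xor-assoc
      }
    ; identity = zipWith-identityˡ xor-identityˡ , zipWith-identityʳ xor-identityʳ
    }
  ; comm = zipWith-comm xor-comm
  }

⊕-commutativeMonoid : ℕ → CommutativeMonoid 0ℓ 0ℓ
⊕-commutativeMonoid k = record { isCommutativeMonoid = ⊕-isCommutativeMonoid k }

true≢false : true ≢ false
true≢false ()

xor≡false⇒≡ : ∀ {a b} → a xor b ≡ false → a ≡ b
xor≡false⇒≡ {false} {false} _ = refl
xor≡false⇒≡ {true}  {true}  _ = refl

_⊆_ : Vector Bool r → Vector Bool r → Set
c ⊆ μ = ∀ i → c i ≡ true → μ i ≡ true

insert remove : Vector Bool r → Fin r → Vector Bool r
insert μ j = updateAt μ j (const true)
remove μ j = updateAt μ j (const false)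

⁅_⁆ : Fin r → Vector Bool r
⁅ j ⁆ = insert (const false) j

_⊕ˢ_ : Vector Bool r → Vector Bool r → Vector Bool r
_⊕ˢ_ = Vector.zipWith _xor_

_∖_ : Vector Bool r → Vector Bool r → Vector Bool r
(μ′ ∖ μ) i = μ′ i ∧ not (μ i)

⊆-trans : {c d μ : Vector Bool r} → c ⊆ d → d ⊆ μ → c ⊆ μ
⊆-trans c⊆d d⊆μ i = d⊆μ i ∘ c⊆d i

⊆⇒false : {c μ : Vector Bool r} → c ⊆ μ → ∀ {i} → μ i ≡ false → c i ≡ false
⊆⇒false {c = c} c⊆μ {i} μi with c i in ci
... | false = refl
... | true  with () ← ≡.trans (sym (c⊆μ i ci)) μi

⊕ˢ-⊆ : {c d μ : Vector Bool r} → c ⊆ μ → d ⊆ μ → (c ⊕ˢ d) ⊆ μ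
⊕ˢ-⊆ {c = c} c⊆μ d⊆μ i cdi with c i in ci
... | true  = c⊆μ i ci
... | false = d⊆μ i cdi

⊆-or-new : (μ′ μ : Vector Bool r) → μ′ ⊆ μ ⊎ ∃[ i ] (μ′ i ≡ true × μ i ≡ false)
⊆-or-new μ′ μ with any? (λ i → (μ′ i ≟ᵇ true) ×-dec (μ i ≟ᵇ false))
... | yes new  = inj₂ new
... | no  ¬new = inj₁ μ′⊆μ
  where
  μ′⊆μ : μ′ ⊆ μ
  μ′⊆μ i μ′i with μ i in μi
  ... | true  = refl
  ... | false = ⊥-elim (¬new (i , μ′i , μi))

⊆-insert : (μ : Vector Bool r) (j : Fin r) → μ ⊆ insert μ j
⊆-insert μ j i μi with i ≟ j
... | yes refl = updateAt-updates j μ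
... | no  i≢j  = ≡.trans (updateAt-minimal i j μ i≢j) μi

remove-⊆ : (μ : Vector Bool r) (j : Fin r) → remove μ j ⊆ μ
remove-⊆ μ j i μ′i with i ≟ j
... | yes refl with () ← ≡.trans (sym μ′i) (updateAt-updates j μ)
... | no  i≢j  = ≡.trans (sym (updateAt-minimal i j μ i≢j)) μ′i

insert-⊆ : {c μ : Vector Bool r} {j : Fin r} → c ⊆ insert μ j → c j ≡ false → c ⊆ μ
insert-⊆ {μ = μ} {j} c⊆ cj i ci with i ≟ j
... | yes refl with () ← ≡.trans (sym ci) cj
... | no  i≢j  = ≡.trans (sym (updateAt-minimal i j μ i≢j)) (c⊆ i ci)

⊆-remove : {c μ : Vector Bool r} {j : Fin r} → c ⊆ μ → c j ≡ false → c ⊆ remove μ j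
⊆-remove {μ = μ} {j} c⊆ cj i ci with i ≟ j
... | yes refl with () ← ≡.trans (sym ci) cj
... | no  i≢j  = ≡.trans (updateAt-minimal i j μ i≢j) (c⊆ i ci)

insert-remove : (μ : Vector Bool r) (j : Fin r) → μ j ≡ true → insert (remove μ j) j ≗ μ
insert-remove μ j μj i with i ≟ j
... | yes refl = ≡.trans (updateAt-updates j (remove μ j)) (sym μj)
... | no  i≢j  = ≡.trans (updateAt-minimal i j (remove μ j) i≢j) (updateAt-minimal i j μ i≢j)

⁅⁆-self : (j : Fin r) → ⁅ j ⁆ j ≡ true
⁅⁆-self j = updateAt-updates j (const false)

⁅⁆-⊆ : {μ : Vector Bool r} {j : Fin r} → μ j ≡ true → ⁅ j ⁆ ⊆ μ
⁅⁆-⊆ {j = j} μj i ji with i ≟ j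
... | yes refl = μj
... | no  i≢j  with () ← ≡.trans (sym ji) (updateAt-minimal i j (const false) i≢j)

⁅⁆-true⇒≡ : {i j : Fin r} → ⁅ j ⁆ i ≡ true → i ≡ j
⁅⁆-true⇒≡ {i = i} {j} ji with i ≟ j
... | yes i≡j = i≡j
... | no  i≢j  with () ← ≡.trans (sym ji) (updateAt-minimal i j (const false) i≢j)

-- Sublists selected by a subset of positions

-- A subfamily of L is encoded by its indicator on the positions of L; `select` recovers the
-- sublist, which is how families of cycles (in particular the states of the chain) are represented.
Selection : List A → Set
Selection L = Vector Bool (length L)

select : (L : List A) → Selection L → List A
select []      c = []
select (x ∷ L) c = if c zero then x ∷ select L (tail c) else select L (tail c)

select-cong : (L : List A) {c d : Selection L} → c ≗ d → select L c ≡ select L d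
select-cong []      c≗d = refl
select-cong (x ∷ L) c≗d rewrite c≗d zero | select-cong L (c≗d ∘ suc) = refl

select-none : (L : List A) → select L (const false) ≡ []
select-none []      = refl
select-none (x ∷ L) = select-none L

select-all : (L : List A) → select L (const true) ≡ L
select-all []      = refl
select-all (x ∷ L) = cong (x ∷_) (select-all L)

null-select : (L : List A) (c : Selection L) → T (null (select L c)) → ∀ i → c i ≡ false
null-select (x ∷ L) c null-c i with c zero in c₀
null-select (x ∷ L) c null-c zero    | false = c₀
null-select (x ∷ L) c null-c (suc i) | false = null-select L (tail c) null-c i

∈-select⁺ : (L : List A) (c : Selection L) {j : Fin (length L)} → c j ≡ true → lookup L j ∈ select L c
∈-select⁺ (x ∷ L) c {zero}  cj rewrite cj = here refl
∈-select⁺ (x ∷ L) c {suc j} cj with c zero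
... | true  = there (∈-select⁺ L (tail c) cj)
... | false = ∈-select⁺ L (tail c) cj

∈-select⁻ : (L : List A) (c : Selection L) {y : A} → y ∈ select L c → ∃[ i ] (c i ≡ true × lookup L i ≡ y)
∈-select⁻ (x ∷ L) c y∈ with c zero in c₀ | y∈
... | true  | here refl = zero , c₀ , refl
... | true  | there y∈′ = let i , ci , eq = ∈-select⁻ L (tail c) y∈′ in suc i , ci , eq
... | false | y∈′       = let i , ci , eq = ∈-select⁻ L (tail c) y∈′ in suc i , ci , eq

filterᵇ-select : (p : A → Bool) (L : List A) → filterᵇ p L ≡ select L (p ∘ lookup L)
filterᵇ-select p []      = refl
filterᵇ-select p (x ∷ L) with p x
... | true  = cong (x ∷_) (filterᵇ-select p L)
... | false = filterᵇ-select p L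

select-∈-sublists : (L : List A) {c μ : Selection L} → c ⊆ μ → select L c ∈ sublists (select L μ)
select-∈-sublists []      c⊆μ = here refl
select-∈-sublists (x ∷ L) {c} {μ} c⊆μ with c zero in c₀ | μ zero in μ₀
... | false | false = select-∈-sublists L (c⊆μ ∘ suc)
... | false | true  = ∈-++⁺ˡ (select-∈-sublists L (c⊆μ ∘ suc))
... | true  | true  = ∈-++⁺ʳ _ (∈-map⁺ (x ∷_) (select-∈-sublists L (c⊆μ ∘ suc)))
... | true  | false with () ← ≡.trans (sym (c⊆μ zero c₀)) μ₀

∷-⊆ : ∀ {b} {c : Vector Bool r} {μ : Vector Bool (suc r)} →
      (b ≡ true → μ zero ≡ true) → c ⊆ tail μ → (b Vector.∷ c) ⊆ μ
∷-⊆ b⊆ c⊆ zero    = b⊆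
∷-⊆ b⊆ c⊆ (suc i) = c⊆ i

∈-sublists-select : (L : List A) (μ : Selection L) {S : List A} →
                    S ∈ sublists (select L μ) → ∃[ c ] (c ⊆ μ × S ≡ select L c)
∈-sublists-select []      μ (here refl) = (λ ()) , (λ ()) , refl
∈-sublists-select (x ∷ L) μ S∈ with μ zero in μ₀
... | false = let c , c⊆ , S≡ = ∈-sublists-select L (tail μ) S∈ in
  (false Vector.∷ c) , ∷-⊆ (λ ()) c⊆ , S≡
... | true with ∈-++⁻ (sublists (select L (tail μ))) S∈
...   | inj₁ S∈′ = let c , c⊆ , S≡ = ∈-sublists-select L (tail μ) S∈′ in
  (false Vector.∷ c) , ∷-⊆ (λ ()) c⊆ , S≡
...   | inj₂ S∈′ with ∈-map⁻ (x ∷_) S∈′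
...     | _ , S′∈ , refl = let c , c⊆ , S′≡ = ∈-sublists-select L (tail μ) S′∈ in
  (true Vector.∷ c) , ∷-⊆ (const μ₀) c⊆ , cong (x ∷_) S′≡

select-∈-sublists-all : (L : List A) (c : Selection L) → select L c ∈ sublists L
select-∈-sublists-all L c =
  subst (λ X → select L c ∈ sublists X) (select-all L) (select-∈-sublists L (λ _ _ → refl))

∈-sublists⇒select : (L : List A) {S : List A} → S ∈ sublists L → ∃[ c ] (S ≡ select L c)
∈-sublists⇒select L S∈
  with ∈-sublists-select L (const true) (subst (λ X → _ ∈ sublists X) (sym (select-all L)) S∈)
... | c , _ , S≡ = c , S≡

∈-sublists⇒∈ : (L : List A) {S : List A} {y : A} → S ∈ sublists L → y ∈ S → y ∈ L
∈-sublists⇒∈ []      (here refl) ()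
∈-sublists⇒∈ (x ∷ L) S∈ y∈ with ∈-++⁻ (sublists L) S∈
... | inj₁ S∈′ = there (∈-sublists⇒∈ L S∈′ y∈)
... | inj₂ S∈′ with ∈-map⁻ (x ∷_) S∈′ | y∈
...   | _ , _   , refl | here y≡x  = here y≡x
...   | _ , S′∈ , refl | there y∈′ = there (∈-sublists⇒∈ L S′∈ y∈′)

sublists-unique : {L : List A} → Unique L → Unique (sublists L)
sublists-unique []                   = All.[] ∷ []
sublists-unique {L = x ∷ L} (x∉ ∷ u) =
  Unique.++⁺ (sublists-unique u) (Unique.map⁺ List.∷-injectiveʳ (sublists-unique u)) disjoint
  where
  disjoint : Disjoint (sublists L) (map (x ∷_) (sublists L))
  disjoint (S∈ , S∈′) with ∈-map⁻ (x ∷_) S∈′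
  ... | _ , _ , refl = All.lookup x∉ (∈-sublists⇒∈ L S∈ (here refl)) refl

allSets-unique : ∀ k → Unique (allSets k)
allSets-unique zero    = All.[] ∷ []
allSets-unique (suc k) =
  Unique.++⁺ (Unique.map⁺ Vec.∷-injectiveʳ u) (Unique.map⁺ Vec.∷-injectiveʳ u) disjoint
  where
  u = allSets-unique k
  disjoint : Disjoint (map (false ∷_) (allSets k)) (map (true ∷_) (allSets k))
  disjoint (v∈₀ , v∈₁) with ∈-map⁻ (false ∷_) v∈₀ | ∈-map⁻ (true ∷_) v∈₁
  ... | _ , _ , refl | _ , _ , ()

lookup-injective : {L : List A} → Unique L → ∀ {i j} → lookup L i ≡ lookup L j → i ≡ j
lookup-injective {L = x ∷ L} _        {zero}  {zero}  _  = refl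
lookup-injective {L = x ∷ L} (x∉ ∷ _) {zero}  {suc j} eq = ⊥-elim (All.lookup x∉ (∈-lookup j) eq)
lookup-injective {L = x ∷ L} (x∉ ∷ _) {suc i} {zero}  eq = ⊥-elim (All.lookup x∉ (∈-lookup i) (sym eq))
lookup-injective {L = x ∷ L} (_ ∷ u)  {suc i} {suc j} eq = cong suc (lookup-injective u eq)

unique-≥2⇒¬all≡ : {xs : List A} → Unique xs → 2 ≤ length xs → ∀ {x} → ¬ (∀ {y} → y ∈ xs → y ≡ x)
unique-≥2⇒¬all≡ {xs = _ ∷ []}    _                    (s≤s ())
unique-≥2⇒¬all≡ {xs = _ ∷ _ ∷ _} ((a≢b All.∷ _) ∷ _) _ all≡ =
  a≢b (≡.trans (all≡ (here refl)) (sym (all≡ (there (here refl)))))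

module _ {c ℓ} (M : CommutativeMonoid c ℓ) where
  open CommutativeMonoid M using (Carrier; _≈_; _∙_; ε; setoid; commutativeSemigroup; ∙-congˡ)
  open CommutativeSemigroupProperties commutativeSemigroup using (x∙yz≈y∙xz)
  open SetoidReasoning setoid

  foldMap : (A → Carrier) → List A → Carrier
  foldMap f = foldr (λ x s → f x ∙ s) ε

  foldMap-select-insert : (f : A → Carrier) (L : List A) (μ : Selection L) (j : Fin (length L)) → μ j ≡ false →
                          foldMap f (select L (insert μ j)) ≈ f (lookup L j) ∙ foldMap f (select L μ)
  foldMap-select-insert f (x ∷ L) μ zero    μ₀ rewrite μ₀ = begin _ ∎
  foldMap-select-insert f (x ∷ L) μ (suc j) μj with μ zero
  ... | false = foldMap-select-insert f L (tail μ) j μj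
  ... | true  = begin
    f x ∙ foldMap f (select L (insert (tail μ) j))          ≈⟨ ∙-congˡ (foldMap-select-insert f L (tail μ) j μj) ⟩
    f x ∙ (f (lookup L j) ∙ foldMap f (select L (tail μ)))  ≈⟨ x∙yz≈y∙xz _ _ _ ⟩
    f (lookup L j) ∙ (f x ∙ foldMap f (select L (tail μ)))  ∎

-- Linear combinations and bases

module _ {k : ℕ} where
  open CommutativeMonoid (⊕-commutativeMonoid k) using (assoc; identityˡ; identityʳ; commutativeSemigroup)
  open CommutativeSemigroupProperties commutativeSemigroup using (x∙yz≈y∙xz; interchange)
  open ≡-Reasoning

  comb : (L : List (Vec Bool k)) → Selection L → Vec Bool k
  comb L c = sumF (select L c)

  comb-insert : (L : List (Vec Bool k)) (μ : Selection L) (j : Fin (length L)) →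
                μ j ≡ false → comb L (insert μ j) ≡ lookup L j ⊕ comb L μ
  comb-insert = foldMap-select-insert (⊕-commutativeMonoid k) (λ x → x)

  comb-none : (L : List (Vec Bool k)) → comb L (const false) ≡ empty
  comb-none L = cong sumF (select-none L)

  comb-⁅⁆ : (L : List (Vec Bool k)) (j : Fin (length L)) → comb L ⁅ j ⁆ ≡ lookup L j
  comb-⁅⁆ L j = begin
    comb L ⁅ j ⁆                       ≡⟨ comb-insert L (const false) j refl ⟩
    lookup L j ⊕ comb L (const false)  ≡⟨ cong (lookup L j ⊕_) (comb-none L) ⟩
    lookup L j ⊕ empty                 ≡⟨ identityʳ (lookup L j) ⟩
    lookup L j                         ∎

  comb-remove : (L : List (Vec Bool k)) (c : Selection L) (j : Fin (length L)) →
                c j ≡ true → comb L c ≡ lookup L j ⊕ comb L (remove c j)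
  comb-remove L c j cj = begin
    comb L c                          ≡⟨ cong sumF (select-cong L (sym ∘ insert-remove c j cj)) ⟩
    comb L (insert (remove c j) j)    ≡⟨ comb-insert L (remove c j) j (updateAt-updates j c) ⟩
    lookup L j ⊕ comb L (remove c j)  ∎

  comb-⊕ˢ : (L : List (Vec Bool k)) (c d : Selection L) → comb L (c ⊕ˢ d) ≡ comb L c ⊕ comb L d
  comb-⊕ˢ []      c d = sym (identityˡ empty)
  comb-⊕ˢ (x ∷ L) c d with c zero | d zero | comb-⊕ˢ L (tail c) (tail d)
  ... | false | false | ih = ih
  ... | true  | false | ih = ≡.trans (cong (x ⊕_) ih) (sym (assoc x _ _))
  ... | false | true  | ih = ≡.trans (cong (x ⊕_) ih) (x∙yz≈y∙xz x _ _)
  ... | true  | true  | ih = begin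
    comb L (tail c ⊕ˢ tail d)                      ≡⟨ ih ⟩
    comb L (tail c) ⊕ comb L (tail d)              ≡⟨ identityˡ _ ⟨
    empty ⊕ (comb L (tail c) ⊕ comb L (tail d))    ≡⟨ cong (_⊕ _) (⊕-self x) ⟨
    (x ⊕ x) ⊕ (comb L (tail c) ⊕ comb L (tail d))  ≡⟨ interchange x x _ _ ⟩
    (x ⊕ comb L (tail c)) ⊕ (x ⊕ comb L (tail d))  ∎

  comb-ind : (P : Vec Bool k → Set) → P empty → (∀ {u v} → P u → P v → P (u ⊕ v)) →
             (L : List (Vec Bool k)) (c : Selection L) → (∀ j → c j ≡ true → P (lookup L j)) → P (comb L c)
  comb-ind P P-empty P-⊕ []      c Pc = P-empty
  comb-ind P P-empty P-⊕ (x ∷ L) c Pc with c zero in c₀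
  ... | true  = P-⊕ (Pc zero c₀) (comb-ind P P-empty P-⊕ L (tail c) (Pc ∘ suc))
  ... | false = comb-ind P P-empty P-⊕ L (tail c) (Pc ∘ suc)

  ⊕-moveʳ : {x y z : Vec Bool k} → x ⊕ y ≡ z → x ≡ z ⊕ y
  ⊕-moveʳ {x} {y} {z} x⊕y≡z = begin
    x            ≡⟨ identityʳ x ⟨
    x ⊕ empty    ≡⟨ cong (x ⊕_) (⊕-self y) ⟨
    x ⊕ (y ⊕ y)  ≡⟨ assoc x y y ⟨
    (x ⊕ y) ⊕ y  ≡⟨ cong (_⊕ y) x⊕y≡z ⟩
    z ⊕ y        ∎

module Basis {k : ℕ} (L : List (Vec Bool k)) where

  Represents : Selection L → Selection L → Vec Bool k → Set
  Represents μ c v = c ⊆ μ × comb L c ≡ v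

  Span : Selection L → Vec Bool k → Set
  Span μ v = ∃[ c ] Represents μ c v

  Independent : Selection L → Set
  Independent μ = ∀ c → c ⊆ μ → comb L c ≡ empty → ∀ i → c i ≡ false

  Spanning : Selection L → Set
  Spanning μ = ∀ j → Span μ (lookup L j)

  IsBasis : Selection L → Set
  IsBasis μ = Independent μ × Spanning μ

  totalSize : Selection L → ℕ
  totalSize μ = foldMap +-0-commutativeMonoid size (select L μ)

  IsMCB : Selection L → Set
  IsMCB μ = IsBasis μ × (∀ ν → IsBasis ν → totalSize μ ≤ totalSize ν)

  span-empty : ∀ {μ} → Span μ empty
  span-empty = const false , (λ _ ()) , comb-none L

  span-⊕ : ∀ {μ u v} → Span μ u → Span μ v → Span μ (u ⊕ v)
  span-⊕ (c , c⊆ , c≡) (d , d⊆ , d≡) = c ⊕ˢ d , ⊕ˢ-⊆ c⊆ d⊆ , ≡.trans (comb-⊕ˢ L c d) (cong₂ _⊕_ c≡ d≡)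

  span-member : ∀ {μ j} → μ j ≡ true → Span μ (lookup L j)
  span-member {j = j} μj = ⁅ j ⁆ , ⁅⁆-⊆ μj , comb-⁅⁆ L j

  span-comb : ∀ {μ} c → (∀ j → c j ≡ true → Span μ (lookup L j)) → Span μ (comb L c)
  span-comb {μ} = comb-ind (Span μ) span-empty span-⊕ L

  comb-injective : ∀ {μ c d} → Independent μ → c ⊆ μ → d ⊆ μ → comb L c ≡ comb L d → c ≗ d
  comb-injective {c = c} {d} ind c⊆ d⊆ c≡d i = xor≡false⇒≡ (ind (c ⊕ˢ d) (⊕ˢ-⊆ c⊆ d⊆) c⊕d≡0 i)
    where
    c⊕d≡0 : comb L (c ⊕ˢ d) ≡ empty
    c⊕d≡0 = ≡.trans (comb-⊕ˢ L c d) (≡.trans (cong (_⊕ comb L d) c≡d) (⊕-self (comb L d)))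

  represents-member : ∀ {μ c j} → Independent μ → μ j ≡ true → Represents μ c (lookup L j) → c ≗ ⁅ j ⁆
  represents-member {j = j} ind μj (c⊆ , c≡) =
    comb-injective ind c⊆ (⁅⁆-⊆ μj) (≡.trans c≡ (sym (comb-⁅⁆ L j)))

  spanning-⊆-independent : ∀ {α β} → Independent α → Spanning β → β ⊆ α → α ≗ β
  spanning-⊆-independent {α} {β} ind sp β⊆α i with α i in αi | sp i
  ... | false | _            = sym (⊆⇒false β⊆α αi)
  ... | true  | c , c⊆β , c≡ =
    sym (c⊆β i (≡.trans (represents-member ind αi (⊆-trans c⊆β β⊆α , c≡) i) (⁅⁆-self i)))

  replace : Selection L → Fin (length L) → Fin (length L) → Selection L
  replace μ d c′ = insert (remove μ d) c′

  module _ {μ e : Selection L} {d c′ : Fin (length L)}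
           (μc′ : μ c′ ≡ false) (e-rep : Represents μ e (lookup L c′)) (ed : e d ≡ true) where

    private
      ν   = replace μ d c′
      e⊆μ = proj₁ e-rep

    d≢c′ : d ≢ c′
    d≢c′ refl with () ← ≡.trans (sym (e⊆μ d ed)) μc′

    replace-independent : Independent μ → Independent ν
    replace-independent ind c c⊆ν c≡0 with c c′ in cc′
    ... | false = ind c (⊆-trans (insert-⊆ c⊆ν cc′) (remove-⊆ μ d)) c≡0
    ... | true  = ⊥-elim (true≢false (≡.trans (sym e⊕c₀-d) (ind (e ⊕ˢ c₀) (⊕ˢ-⊆ e⊆μ c₀⊆μ) e⊕c₀≡0 d)))
      where
      open ≡-Reasoning
      c₀ = remove c c′
      c₀⊆μ-d : c₀ ⊆ remove μ d
      c₀⊆μ-d = insert-⊆ (⊆-trans (remove-⊆ c c′) c⊆ν) (updateAt-updates c′ c)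
      c₀⊆μ : c₀ ⊆ μ
      c₀⊆μ = ⊆-trans c₀⊆μ-d (remove-⊆ μ d)
      e⊕c₀-d : (e ⊕ˢ c₀) d ≡ true
      e⊕c₀-d rewrite ed | ⊆⇒false c₀⊆μ-d (updateAt-updates d μ) = refl
      e⊕c₀≡0 : comb L (e ⊕ˢ c₀) ≡ empty
      e⊕c₀≡0 = begin
        comb L (e ⊕ˢ c₀)         ≡⟨ comb-⊕ˢ L e c₀ ⟩
        comb L e ⊕ comb L c₀     ≡⟨ cong (_⊕ comb L c₀) (proj₂ e-rep) ⟩
        lookup L c′ ⊕ comb L c₀  ≡⟨ comb-remove L c c′ cc′ ⟨
        comb L c                 ≡⟨ c≡0 ⟩
        empty                    ∎

    replace-spanning : Spanning μ → Spanning ν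
    replace-spanning sp j with sp j
    ... | c , c⊆μ , c≡ = subst (Span ν) c≡ (span-comb c (λ i ci → μ⊆spanν i (c⊆μ i ci)))
      where
      e-d⊆ν : remove e d ⊆ ν
      e-d⊆ν = ⊆-trans (⊆-remove (⊆-trans (remove-⊆ e d) e⊆μ) (updateAt-updates d e)) (⊆-insert (remove μ d) c′)
      d∈spanν : Span ν (lookup L d)
      d∈spanν = subst (Span ν)
        (sym (⊕-moveʳ (≡.trans (sym (comb-remove L e d ed)) (proj₂ e-rep))))
        (span-⊕ (span-member (updateAt-updates c′ (remove μ d))) (remove e d , e-d⊆ν , refl))
      μ⊆spanν : ∀ i → μ i ≡ true → Span ν (lookup L i)
      μ⊆spanν i μi with i ≟ d
      ... | yes refl = d∈spanν
      ... | no  i≢d  = span-member (⊆-insert (remove μ d) c′ i (≡.trans (updateAt-minimal i d μ i≢d) μi))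

    replace-isBasis : IsBasis μ → IsBasis ν
    replace-isBasis (ind , sp) = replace-independent ind , replace-spanning sp

    totalSize-remove : totalSize μ ≡ size (lookup L d) + totalSize (remove μ d)
    totalSize-remove =
      ≡.trans (cong (foldMap +-0-commutativeMonoid size) (select-cong L (sym ∘ insert-remove μ d (e⊆μ d ed))))
              (foldMap-select-insert +-0-commutativeMonoid size L (remove μ d) d (updateAt-updates d μ))

    totalSize-replace : totalSize ν ≡ size (lookup L c′) + totalSize (remove μ d)
    totalSize-replace = foldMap-select-insert +-0-commutativeMonoid size L (remove μ d) c′
      (≡.trans (updateAt-minimal c′ d μ (d≢c′ ∘ sym)) μc′)

    exchange-size-≤ : IsMCB μ → size (lookup L d) ≤ size (lookup L c′)
    exchange-size-≤ (basis , minimal) = +-cancelʳ-≤ (totalSize (remove μ d)) _ _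
      (subst₂ _≤_ totalSize-remove totalSize-replace (minimal ν (replace-isBasis basis)))

    replace-isMCB : IsMCB μ → size (lookup L d) ≡ size (lookup L c′) → IsMCB ν
    replace-isMCB (basis , minimal) same-size =
      replace-isBasis basis , λ ν′ basis′ → subst (_≤ totalSize ν′) μ≡ν (minimal ν′ basis′)
      where
      μ≡ν : totalSize μ ≡ totalSize ν
      μ≡ν = begin
        totalSize μ                                   ≡⟨ totalSize-remove ⟩
        size (lookup L d) + totalSize (remove μ d)    ≡⟨ cong (_+ totalSize (remove μ d)) same-size ⟩
        size (lookup L c′) + totalSize (remove μ d)   ≡⟨ totalSize-replace ⟨
        totalSize ν                                   ∎
        where open ≡-Reasoning

  exchange-partner : ∀ {μ′ e c′} → IsBasis μ′ → μ′ c′ ≡ true → comb L e ≡ lookup L c′ →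
                     ∃[ d ] (e d ≡ true × ∃[ f ] (Represents μ′ f (lookup L d) × f c′ ≡ true))
  exchange-partner {μ′} {e} {c′} (ind , sp) μ′c′ e≡
    with any? (λ d → (e d ≟ᵇ true) ×-dec (proj₁ (sp d) c′ ≟ᵇ true))
  ... | yes (d , ed , fc′) = d , ed , proj₁ (sp d) , proj₂ (sp d) , fc′
  ... | no  no-partner     with subst (Span (remove μ′ c′)) e≡ (span-comb e in-span)
    where
    in-span : ∀ d → e d ≡ true → Span (remove μ′ c′) (lookup L d)
    in-span d ed with proj₁ (sp d) c′ in fc′
    ... | true  = ⊥-elim (no-partner (d , ed , fc′))
    ... | false = proj₁ (sp d) , ⊆-remove (proj₁ (proj₂ (sp d))) fc′ , proj₂ (proj₂ (sp d))
  ... | g , g⊆ , g≡ = ⊥-elim (true≢false (≡.trans (sym gc′) (⊆⇒false g⊆ (updateAt-updates c′ μ′))))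
    where
    gc′ : g c′ ≡ true
    gc′ = ≡.trans (represents-member ind μ′c′ (⊆-trans g⊆ (remove-⊆ μ′ c′) , g≡) c′) (⁅⁆-self c′)

  symmetric-exchange : ∀ {μ μ′ e c′} → IsMCB μ → IsMCB μ′ → μ c′ ≡ false → μ′ c′ ≡ true →
                       Represents μ e (lookup L c′) →
                       ∃[ d ] (e d ≡ true × μ′ d ≡ false × size (lookup L d) ≡ size (lookup L c′))
  symmetric-exchange {μ′ = μ′} {c′ = c′} mcb mcb′@((ind′ , _) , _) μc′ μ′c′ e-rep
    with exchange-partner (proj₁ mcb′) μ′c′ (proj₂ e-rep)
  ... | d , ed , f , f-rep , fc′ =
    d , ed , μ′d , ≤-antisym (exchange-size-≤ μc′ e-rep ed mcb) (exchange-size-≤ μ′d f-rep fc′ mcb′)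
    where
    μ′d : μ′ d ≡ false
    μ′d with μ′ d in μ′d≡
    ... | false = refl
    ... | true  = ⊥-elim (d≢c′ μc′ e-rep ed (sym (⁅⁆-true⇒≡ ⁅d⁆c′)))
      where
      ⁅d⁆c′ : ⁅ d ⁆ c′ ≡ true
      ⁅d⁆c′ = ≡.trans (sym (represents-member ind′ μ′d≡ f-rep c′)) fc′

  missing : Selection L → Selection L → ℕ
  missing μ′ μ = length (select L (μ′ ∖ μ))

  missing-replace : ∀ {μ μ′ d c′} → μ′ d ≡ false → μ c′ ≡ false → μ′ c′ ≡ true →
                    missing μ′ μ ≡ suc (missing μ′ (replace μ d c′))
  missing-replace {μ} {μ′} {d} {c′} μ′d μc′ μ′c′ =
    ≡.trans (cong length (select-cong L diff))
            (foldMap-select-insert +-0-commutativeMonoid (const 1) L (μ′ ∖ ν) c′ c′-not-missing)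
    where
    ν = replace μ d c′
    c′-not-missing : (μ′ ∖ ν) c′ ≡ false
    c′-not-missing = ≡.trans (cong (λ b → μ′ c′ ∧ not b) (updateAt-updates c′ (remove μ d))) (∧-zeroʳ (μ′ c′))
    agree : ∀ i → i ≢ c′ → (μ′ ∖ μ) i ≡ (μ′ ∖ ν) i
    agree i i≢c′ with i ≟ d
    ... | yes refl rewrite μ′d = refl
    ... | no  i≢d  = cong (λ b → μ′ i ∧ not b)
      (sym (≡.trans (updateAt-minimal i c′ (remove μ d) i≢c′) (updateAt-minimal i d μ i≢d)))
    diff : μ′ ∖ μ ≗ insert (μ′ ∖ ν) c′
    diff i with i ≟ c′
    ... | yes refl rewrite μ′c′ | μc′ = sym (updateAt-updates c′ (μ′ ∖ ν))
    ... | no  i≢c′ = ≡.trans (agree i i≢c′) (sym (updateAt-minimal i c′ (μ′ ∖ ν) i≢c′))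

-- Minimum cycle bases of a graph

==⇒≡ : ∀ {k} {x y : Vec Bool k} → T (x == y) → x ≡ y
==⇒≡ {x = x} {y} with ≡-dec _≟ᵇ_ x y
... | yes x≡y = λ _ → x≡y

==-refl : ∀ {k} (x : Vec Bool k) → T (x == x)
==-refl x = Equivalence.from T-≡ (dec-true (≡-dec _≟ᵇ_ x x) refl)

≡⇒== : ∀ {k} {x y : Vec Bool k} → x ≡ y → T (x == y)
≡⇒== {x = x} refl = ==-refl x

T-∈ᵇ : ∀ {k} {x : Vec Bool k} {F} → T (x ∈ᵇ F) ⇔ x ∈ F
T-∈ᵇ = mk⇔ (Any.map ==⇒≡ ∘ any⁻ _ _) (any⁺ _ ∘ Any.map ≡⇒==)

==L-refl : ∀ {k} (F : List (Vec Bool k)) → T (F ==L F)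
==L-refl []      = _
==L-refl (x ∷ F) = Equivalence.from T-∧ (==-refl x , ==L-refl F)

firstOr-∈ : ∀ G {A : Set} {d : A} {xs x} → x ∈ xs → firstOr G d xs ∈ xs
firstOr-∈ G {xs = _ ∷ _} _ = here refl

module CycleSpace (G : Graph) where

  open Basis (cycles G) public

  private
    L   = cycles G
    cyc = lookup L

  cycles-unique : Unique L
  cycles-unique = Unique.filter⁺ (T? ∘ isCycle G) (allSets-unique (m G))

  ==-lookup : (i j : Fin (length L)) → (cyc i == cyc j) ≡ does (i ≟ j)
  ==-lookup i j with i ≟ j
  ... | yes refl = Equivalence.to T-≡ (==-refl (cyc i))
  ... | no  i≢j  = dec-false (≡-dec _≟ᵇ_ (cyc i) (cyc j)) (i≢j ∘ lookup-injective cycles-unique)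

  ∈ᵇ-select : (μ : Selection L) (j : Fin (length L)) → (cyc j ∈ᵇ select L μ) ≡ μ j
  ∈ᵇ-select μ j = ⇔→≡ (mk⇔ (selected ∘ Equivalence.to T-∈ᵇ ∘ Equivalence.from T-≡)
                           (Equivalence.to T-≡ ∘ Equivalence.from T-∈ᵇ ∘ ∈-select⁺ L μ))
    where
    selected : cyc j ∈ select L μ → μ j ≡ true
    selected j∈ with ∈-select⁻ L μ j∈
    ... | i , μi , i≡j = subst (λ i → μ i ≡ true) (lookup-injective cycles-unique i≡j) μi

  independent-sound : ∀ μ → T (independent G (select L μ)) → Independent μ
  independent-sound μ indᵇ c c⊆μ c≡0 = null-select L c (null-or-nonzero (Equivalence.to T-∨ test))
    where
    test : T (null (select L c) ∨ not (comb L c == empty))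
    test = All.lookup (all⁺ _ _ indᵇ) (select-∈-sublists L c⊆μ)
    null-or-nonzero : T (null (select L c)) ⊎ T (not (comb L c == empty)) → T (null (select L c))
    null-or-nonzero (inj₁ null-c)  = null-c
    null-or-nonzero (inj₂ nonzero)
      with () ← ≡.trans (sym (Equivalence.to T-≡ (≡⇒== c≡0))) (Equivalence.to T-not-≡ nonzero)

  independent-complete : ∀ μ → Independent μ → T (independent G (select L μ))
  independent-complete μ ind = all⁻ _ (All.tabulate test)
    where
    test : ∀ {S} → S ∈ sublists (select L μ) → T (null S ∨ not (sumF S == empty))
    test S∈ with ∈-sublists-select L μ S∈
    ... | c , c⊆μ , refl with comb L c == empty in c≡0
    ... | false = Equivalence.from (T-∨ {null (select L c)}) (inj₂ _)
    ... | true  = Equivalence.from (T-∨ {null (select L c)}) (inj₁ (subst (T ∘ null) (sym select≡[]) _))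
      where
      select≡[] : select L c ≡ []
      select≡[] = ≡.trans (select-cong L (ind c c⊆μ (==⇒≡ (Equivalence.from T-≡ c≡0)))) (select-none L)

  spanned-by : Selection L → EdgeSet G → Bool
  spanned-by μ C = any (λ S → sumF S == C) (sublists (select L μ))

  spans-sound : ∀ μ → T (spans G (select L μ)) → Spanning μ
  spans-sound μ spᵇ j with find (any⁻ _ _ (All.lookup (all⁺ (spanned-by μ) L spᵇ) (∈-lookup j)))
  ... | S , S∈ , S≡ with ∈-sublists-select L μ S∈
  ... | c , c⊆μ , refl = c , c⊆μ , ==⇒≡ S≡

  spans-complete : ∀ μ → Spanning μ → T (spans G (select L μ))
  spans-complete μ sp = all⁻ (spanned-by μ) (All.tabulate {xs = L} λ C∈ → test (Any.index C∈) (lookup-index C∈))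
    where
    test : ∀ j {C} → C ≡ cyc j → T (spanned-by μ C)
    test j refl with sp j
    ... | c , c⊆μ , c≡ = any⁺ _ (lose (select-∈-sublists L c⊆μ) (≡⇒== c≡))

  isBasis-sound : ∀ μ → T (isBasis G (select L μ)) → IsBasis μ
  isBasis-sound μ basisᵇ with Equivalence.to T-∧ basisᵇ
  ... | indᵇ , spᵇ = independent-sound μ indᵇ , spans-sound μ spᵇ

  isBasis-complete : ∀ μ → IsBasis μ → T (isBasis G (select L μ))
  isBasis-complete μ (ind , sp) = Equivalence.from T-∧ (independent-complete μ ind , spans-complete μ sp)

  ∈-bases⁺ : ∀ μ → IsBasis μ → select L μ ∈ bases G
  ∈-bases⁺ μ basis = ∈-filter⁺ (T? ∘ isBasis G) (select-∈-sublists-all L μ) (isBasis-complete μ basis)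

  ∈-bases⁻ : ∀ {B} → B ∈ bases G → ∃[ ν ] (B ≡ select L ν × IsBasis ν)
  ∈-bases⁻ B∈ with ∈-filter⁻ (T? ∘ isBasis G) B∈
  ... | S∈ , basisᵇ with ∈-sublists⇒select L S∈
  ... | ν , refl = ν , refl , isBasis-sound ν basisᵇ

  isMCB-sound : ∀ μ → T (isMCB G (select L μ)) → IsMCB μ
  isMCB-sound μ mcbᵇ with Equivalence.to T-∧ mcbᵇ
  ... | basisᵇ , minimalᵇ =
    isBasis-sound μ basisᵇ , λ ν basis → ≤ᵇ⇒≤ _ _ (All.lookup (all⁺ _ _ minimalᵇ) (∈-bases⁺ ν basis))

  isMCB-complete : ∀ μ → IsMCB μ → T (isMCB G (select L μ))
  isMCB-complete μ (basis , minimal) =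
    Equivalence.from T-∧ (isBasis-complete μ basis , all⁻ _ (All.tabulate minimalᵇ))
    where
    minimalᵇ : ∀ {B} → B ∈ bases G → T (weight G (select L μ) ≤ᵇ weight G B)
    minimalᵇ B∈ with ∈-bases⁻ B∈
    ... | ν , refl , basis′ = ≤⇒≤ᵇ (minimal ν basis′)

  ∈-mcbs⁺ : ∀ {μ} → IsMCB μ → select L μ ∈ mcbs G
  ∈-mcbs⁺ {μ} mcb = ∈-filter⁺ (T? ∘ isMCB G) (select-∈-sublists-all L μ) (isMCB-complete μ mcb)

  ∈-mcbs⁻ : ∀ {M} → M ∈ mcbs G → ∃[ μ ] (M ≡ select L μ × IsMCB μ)
  ∈-mcbs⁻ M∈ with ∈-filter⁻ (T? ∘ isMCB G) M∈
  ... | S∈ , mcbᵇ with ∈-sublists⇒select L S∈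
  ... | μ , refl = μ , refl , isMCB-sound μ mcbᵇ

  mcbs-unique : Unique (mcbs G)
  mcbs-unique = Unique.filter⁺ (T? ∘ isMCB G) (sublists-unique cycles-unique)

  expansion-select : ∀ {μ} → Spanning μ → ∀ j →
                     ∃[ e ] (Represents μ e (cyc j) × expansion G (select L μ) (cyc j) ≡ select L e)
  expansion-select {μ} sp j with sp j
  ... | c , c⊆μ , c≡ with ∈-filter⁻ (T? ∘ sums-to) (firstOr-∈ G c∈)
    where
    sums-to : List (EdgeSet G) → Bool
    sums-to S = sumF S == cyc j
    c∈ : select L c ∈ filterᵇ sums-to (sublists (select L μ))
    c∈ = ∈-filter⁺ (T? ∘ sums-to) (select-∈-sublists L c⊆μ) (≡⇒== c≡)
  ... | S∈ , S≡ with ∈-sublists-select L μ S∈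
  ... | e , e⊆μ , exp≡ = e , (e⊆μ , ≡.trans (cong sumF (sym exp≡)) (==⇒≡ S≡)) , exp≡

  exchange-select : ∀ μ {d c′} → d ≢ c′ → exchange G (select L μ) (cyc c′) (cyc d) ≡ select L (replace μ d c′)
  exchange-select μ {d} {c′} d≢c′ rewrite ==-lookup d c′ | dec-false (d ≟ c′) d≢c′ =
    ≡.trans (filterᵇ-select _ L) (select-cong L kept)
    where
    kept : ∀ i → ((cyc i ∈ᵇ select L μ) ∧ not (cyc i == cyc d)) ∨ (cyc i == cyc c′) ≡ replace μ d c′ i
    kept i rewrite ∈ᵇ-select μ i | ==-lookup i d | ==-lookup i c′ with i ≟ c′ | i ≟ d
    ... | yes refl | _        = ≡.trans (∨-zeroʳ _) (sym (updateAt-updates c′ (remove μ d)))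
    ... | no  i≢c′ | yes refl =
      ≡.trans (∨-identityʳ _) (≡.trans (∧-zeroʳ (μ d))
        (sym (≡.trans (updateAt-minimal d c′ (remove μ d) i≢c′) (updateAt-updates d μ))))
    ... | no  i≢c′ | no  i≢d  =
      ≡.trans (∨-identityʳ _) (≡.trans (∧-identityʳ (μ i))
        (sym (≡.trans (updateAt-minimal i c′ (remove μ d) i≢c′) (updateAt-minimal i d μ i≢d))))

  ∈-relevantNotIn : ∀ {μ μ′ j} → IsMCB μ′ → μ′ j ≡ true → μ j ≡ false → cyc j ∈ relevantNotIn G (select L μ)
  ∈-relevantNotIn {μ} {μ′} {j} mcb′ μ′j μj =
    ∈-filter⁺ (T? ∘ λ C → not (C ∈ᵇ select L μ)) relevant-j
      (Equivalence.from T-not-≡ (≡.trans (∈ᵇ-select μ j) μj))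
    where
    relevant-j : cyc j ∈ relevant G
    relevant-j = ∈-filter⁺ (T? ∘ λ C → any (C ∈ᵇ_) (mcbs G)) (∈-lookup {xs = L} j)
      (any⁺ (cyc j ∈ᵇ_) (lose (∈-mcbs⁺ mcb′) (Equivalence.from T-∈ᵇ (∈-select⁺ L μ′ μ′j))))

-- The Markov chain

sumℚ-nonNeg : (f : A → ℚ) (xs : List A) → (∀ {x} → x ∈ xs → NonNegative (f x)) → NonNegative (sumℚ f xs)
sumℚ-nonNeg f []       _   = _
sumℚ-nonNeg f (x ∷ xs) f≥0 =
  nonNeg+nonNeg⇒nonNeg (f x) {{f≥0 (here refl)}} (sumℚ f xs) {{sumℚ-nonNeg f xs (f≥0 ∘ there)}}

sumℚ-pos : (f : A → ℚ) (xs : List A) → (∀ {x} → x ∈ xs → NonNegative (f x)) →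
           ∀ {x} → x ∈ xs → Positive (f x) → Positive (sumℚ f xs)
sumℚ-pos f (x ∷ xs) f≥0 (here refl) fx>0 =
  pos+nonNeg⇒pos (f x) {{fx>0}} (sumℚ f xs) {{sumℚ-nonNeg f xs (f≥0 ∘ there)}}
sumℚ-pos f (x ∷ xs) f≥0 (there y∈) fy>0 =
  nonNeg+pos⇒pos (f x) {{f≥0 (here refl)}} (sumℚ f xs) {{sumℚ-pos f xs (f≥0 ∘ there) y∈ fy>0}}

frac-nonNeg : ∀ a b → NonNegative (frac a b)
frac-nonNeg a zero    = _
frac-nonNeg a (suc b) = normalize-nonNeg a (suc b)

frac-pos : ∀ {a b} → 0 < a → 0 < b → Positive (frac a b)
frac-pos {suc a} {suc b} _ _ = normalize-pos (suc a) (suc b)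

module Chain (G : Graph) where

  open CycleSpace G public

  private
    L   = cycles G
    cyc = lookup L

    choose : List (EdgeSet G) → ℚ
    choose M = frac 1 (length (relevantNotIn G M))

    accept : List (EdgeSet G) → List (EdgeSet G) → EdgeSet G → ℚ
    accept M X C′ = frac (count (λ C → exchange G M C′ C ==L X) (candidates G M C′)) (length (candidates G M C′))

    step-nonNeg : ∀ M X C′ → NonNegative (choose M * accept M X C′)
    step-nonNeg M X C′ =
      nonNeg*nonNeg⇒nonNeg (choose M) {{frac-nonNeg 1 (length (relevantNotIn G M))}} (accept M X C′)
        {{frac-nonNeg (count (λ C → exchange G M C′ C ==L X) (candidates G M C′)) (length (candidates G M C′))}}

  transition-nonNeg : ∀ M X → NonNegative (trans G M X)
  transition-nonNeg M X =
    sumℚ-nonNeg (λ C′ → choose M * accept M X C′) (relevantNotIn G M) (λ {C′} _ → step-nonNeg M X C′)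

  transPow-nonNeg : ∀ k M X → NonNegative (transPow G k M X)
  trans*transPow-nonNeg : ∀ k M X Y → NonNegative (trans G M Y * transPow G k Y X)

  transPow-nonNeg zero    M X with M ==L X
  ... | true  = _
  ... | false = _
  transPow-nonNeg (suc k) M X =
    sumℚ-nonNeg (λ Y → trans G M Y * transPow G k Y X) (mcbs G) (λ {Y} _ → trans*transPow-nonNeg k M X Y)

  trans*transPow-nonNeg k M X Y =
    nonNeg*nonNeg⇒nonNeg (trans G M Y) {{transition-nonNeg M Y}} (transPow G k Y X) {{transPow-nonNeg k Y X}}

  transition-pos : ∀ {M X C′ C} → C′ ∈ relevantNotIn G M → C ∈ candidates G M C′ →
                   T (exchange G M C′ C ==L X) → Positive (trans G M X)
  transition-pos {M} {X} {C′} C′∈ C∈ C↦X =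
    sumℚ-pos (λ C′ → choose M * accept M X C′) (relevantNotIn G M) (λ {C′} _ → step-nonNeg M X C′) C′∈
      (pos*pos⇒pos (choose M) {{frac-pos (s≤s z≤n) (∈-length C′∈)}}
                   (accept M X C′) {{frac-pos count>0 (∈-length C∈)}})
    where
    count>0 : 0 < count (λ C → exchange G M C′ C ==L X) (candidates G M C′)
    count>0 = ∈-length (∈-filter⁺ (T? ∘ λ C → exchange G M C′ C ==L X) C∈ C↦X)

  transPow-zero-pos : ∀ M → Positive (transPow G 0 M M)
  transPow-zero-pos M rewrite Equivalence.to T-≡ (==L-refl M) = _

  transPow-suc-pos : ∀ {k M X M′} → X ∈ mcbs G → Positive (trans G M X) → Positive (transPow G k X M′) →
                     Positive (transPow G (suc k) M M′)
  transPow-suc-pos {k} {M} {X} {M′} X∈ M↦X X↦M′ =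
    sumℚ-pos (λ Y → trans G M Y * transPow G k Y M′) (mcbs G) (λ {Y} _ → trans*transPow-nonNeg k M M′ Y) X∈
      (pos*pos⇒pos (trans G M X) {{M↦X}} (transPow G k X M′) {{X↦M′}})

  replace-pos : ∀ {μ μ′ e d c′} → IsMCB μ′ → μ′ c′ ≡ true → (μc′ : μ c′ ≡ false) →
                (e-rep : Represents μ e (cyc c′)) → expansion G (select L μ) (cyc c′) ≡ select L e →
                e d ≡ true → size (cyc d) ≡ size (cyc c′) →
                Positive (trans G (select L μ) (select L (replace μ d c′)))
  replace-pos {μ} {e = e} {d} {c′} mcb′ μ′c′ μc′ e-rep exp≡ ed same-size =
    transition-pos {C = cyc d} (∈-relevantNotIn mcb′ μ′c′ μc′) d-candidate exchanged
    where
    d-candidate : cyc d ∈ candidates G (select L μ) (cyc c′)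
    d-candidate = ∈-filter⁺ (T? ∘ λ C → size C ≡ᵇ size (cyc c′))
      (there {x = cyc c′} (subst (cyc d ∈_) (sym exp≡) (∈-select⁺ L e ed))) (≡⇒≡ᵇ (size (cyc d)) _ same-size)
    exchanged : T (exchange G (select L μ) (cyc c′) (cyc d) ==L select L (replace μ d c′))
    exchanged = subst (λ X → T (X ==L select L (replace μ d c′)))
      (sym (exchange-select μ (d≢c′ μc′ e-rep ed))) (==L-refl (select L (replace μ d c′)))

  approach : ∀ {μ μ′} → IsMCB μ → IsMCB μ′ →
             μ ≗ μ′ ⊎ ∃[ ν ] (IsMCB ν × Positive (trans G (select L μ) (select L ν)) ×
                              missing μ′ μ ≡ suc (missing μ′ ν))
  approach {μ} {μ′} mcb@((ind , sp) , _) mcb′@((_ , sp′) , _) with ⊆-or-new μ′ μ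
  ... | inj₁ μ′⊆μ = inj₁ (spanning-⊆-independent ind sp′ μ′⊆μ)
  ... | inj₂ (c′ , μ′c′ , μc′) with expansion-select sp c′
  ... | e , e-rep , exp≡ with symmetric-exchange mcb mcb′ μc′ μ′c′ e-rep
  ... | d , ed , μ′d , same-size =
    inj₂ (replace μ d c′ , replace-isMCB μc′ e-rep ed mcb same-size ,
          replace-pos mcb′ μ′c′ μc′ e-rep exp≡ ed same-size , missing-replace μ′d μc′ μ′c′)

  reachable : ∀ n {μ μ′} → IsMCB μ → IsMCB μ′ → missing μ′ μ ≡ n →
              ∃[ k ] Positive (transPow G k (select L μ) (select L μ′))
  reachable n {μ} mcb mcb′ missing≡n with approach mcb mcb′
  ... | inj₁ μ≗μ′ =
    0 , subst (Positive ∘ transPow G 0 (select L μ)) (select-cong L μ≗μ′) (transPow-zero-pos (select L μ))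
  reachable zero    mcb mcb′ missing≡n | inj₂ (_ , _ , _ , closer) with () ← ≡.trans (sym closer) missing≡n
  reachable (suc n) mcb mcb′ missing≡n | inj₂ (ν , mcbν , μ↦ν , closer)
    with reachable n mcbν mcb′ (suc-injective (≡.trans (sym closer) missing≡n))
  ... | k , ν↦μ′ = suc k , transPow-suc-pos {k} (∈-mcbs⁺ mcbν) μ↦ν ν↦μ′

  self-loop-pos : ∀ {M C′} → C′ ∈ relevantNotIn G M → Positive (trans G M M)
  self-loop-pos {M} {C′} C′∈ =
    transition-pos {C = C′} C′∈ C′-candidate stays
    where
    C′-candidate : C′ ∈ candidates G M C′
    C′-candidate = ∈-filter⁺ (T? ∘ λ C → size C ≡ᵇ size C′) (here refl) (≡⇒≡ᵇ (size C′) _ refl)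
    stays : T (exchange G M C′ C′ ==L M)
    stays rewrite Equivalence.to T-≡ (==-refl C′) = ==L-refl M

  relevantNotIn-nonempty : 2 ≤ length (mcbs G) → ∀ {μ} → IsMCB μ → ∃[ C′ ] C′ ∈ relevantNotIn G (select L μ)
  relevantNotIn-nonempty two {μ} ((ind , _) , _) with relevantNotIn G (select L μ) in none
  ... | C′ ∷ _ = C′ , here refl
  ... | []     = ⊥-elim (unique-≥2⇒¬all≡ mcbs-unique two all≡μ)
    where
    all≡μ : ∀ {X} → X ∈ mcbs G → X ≡ select L μ
    all≡μ X∈ with ∈-mcbs⁻ X∈
    ... | ξ , refl , mcbξ@((_ , spξ) , _) with ⊆-or-new ξ μ
    ...   | inj₁ ξ⊆μ = sym (select-cong L (spanning-⊆-independent ind spξ ξ⊆μ))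
    ...   | inj₂ (i , ξi , μi) with () ← subst (cyc i ∈_) none (∈-relevantNotIn mcbξ ξi μi)

proposition1 : (G : Graph) → 2 ≤ length (mcbs G) → Ergodic G
proposition1 G two = irreducible , aperiodic
  where
  open Chain G

  irreducible : Irreducible G
  irreducible _ _ M∈ M′∈ with ∈-mcbs⁻ M∈ | ∈-mcbs⁻ M′∈
  ... | μ , refl , mcb | μ′ , refl , mcb′ with reachable _ mcb mcb′ refl
  ... | k , M↦M′ = k , positive⁻¹ _ {{M↦M′}}

  aperiodic : Aperiodic G
  aperiodic M M∈ d d∣returns with ∈-mcbs⁻ M∈
  ... | μ , refl , mcb with relevantNotIn-nonempty two mcb
  ... | C′ , C′∈ = ∣1⇒≡1 (d∣returns 1 ≤-refl (positive⁻¹ _ {{M↦M}}))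
    where
    M↦M : Positive (transPow G 1 M M)
    M↦M = transPow-suc-pos {0} M∈ (self-loop-pos C′∈) (transPow-zero-pos M)
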